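{- Let $F(X,Y)$ be a propositional formula over disjoint variable sets $X$ (relevant) and $Y$ (irrelevant), let $P$ be a CNF over $X\cup Y\cup S$ with $\exists S\,[P]\equiv F$ (Tseitin encoding of $F$), and let $N = t_0\wedge \mathrm{Tseitin}(t_0\leftrightarrow\neg F)$ be a CNF over $X\cup Y\cup T$ with $\exists T\,[N]\equiv\neg F$ and $S\cap T=\emptyset$. Then every run of the irredundant projected model enumeration procedure described in the context, started on $P$, $N$ with empty trail, all variables unassigned and $M=\bot$, terminates after finitely many steps.
   Context: Procedure (irredundant projected model enumeration). State: a trail $I$ (a sequence of literals over $X\cup Y\cup S$ with pairwise distinct variables, each literal being either a decision literal or a propagated literal annotated with a reason clause), the decision level $\delta(\ell)$ of each assigned literal (literals before the first decision have level $0$; a decision literal opens a new level one higher than the current level $\delta(I)$, the maximum level on $I$; for a clause $C$, $\delta(C)$ is the maximum level of its literals), a DNF $M$ over $X$ (initially the empty disjunction $\bot$), and a counter $i$ (initially $0$). Repeat: (1) Unit propagation: if no clause of $P$ is falsified by $I$ and some clause $C\in P$ has all literals false under $I$ except one unassigned literal $\ell$, append $\ell$ to $I$ as propagated literal with reason $C$ at level $\delta(I)$. (2) Conflict: if some clause $C\in P$ is falsified by $I$: if $\delta(C)=0$, stop and output $M$. Otherwise derive by resolution with reasons on the trail a clause $D$ with $P\models D$, all literals false under $I$, and exactly one literal $\ell$ at level $\delta(I)$; add $D$ to $P$; let $j=\delta(D\setminus\{\ell\})$ (with $0$ for the empty clause); remove from $I$ all literals of level $>j$ (unassigning them); append $\ell$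 as propagated with reason $D$ at level $j$. (3) Model: if no clause is falsified and all variables of $X\cup Y\cup S$ are assigned (so $I$ is a total model of $P$): if no decision literal of $I$ has its variable in $X$, stop and output $M\vee I|_X$. Otherwise set $i:=i+1$ and obtain (by an incremental SAT call on $N$ under the assumptions $I|_{X\cup Y}$ followed by conflict analysis, yielding a clause consisting of negated assumption literals) a cube $I^*\subseteq I|_{X\cup Y}$ with $N\wedge I^*$ unsatisfiable. Let $m=I^*|_X$ and let $B$ be the clause of complements of those literals of $m$ that are decision literals on $I$. Set $P:=P\wedge B$; replace in $N$ the clause $(t_0\vee\bigvee_{k=1}^{i-1}t_k)$ by $(t_0\vee\bigvee_{k=1}^{i}t_k)$ and add $\mathrm{Tseitin}(t_i\leftrightarrow \bigwedge\{\text{decision literals of } m\})$ with $t_i$ fresh; set $M:=M\vee m$. Let $\ell\in B$ be its literal of highest level and $b=\delta(B\setminus\{\ell\})$; remove from $I$ all literals of level $>b$, and append $\ell$ as propagated with reason $B$ at level $b$. (4) Decision: otherwise choose an unassigned variable, taking one in $X$ if any is unassigned, else one in $Y\cup S$ (variables of $T$ are never decided in $P$), and append a literal of it to $I$ as a decision literal at level $\delta(I)+1$. Notation: $I|_X$ is the restriction of $I$ to literals over $X$; $\mathrm{Tseitin}(G)$ is the Tseitin CNF encoding of $G$ with fresh auxiliary variables. -}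

module Defs where

open import Data.Nat using (ℕ; zero; suc; _≤_; _<_; _⊔_; _≤ᵇ_; _≡ᵇ_)
open import Data.Bool using (Bool; true; false; not; _∧_; _∨_; if_then_else_)
open import Data.List using (List; []; _∷_; _++_; _∷ʳ_; map; filterᵇ; foldr; concatMap; length)
open import Data.Bool.ListAction using (any)
open import Data.List.Membership.Propositional using (_∈_; _∉_)
open import Data.List.Relation.Unary.All using (All)
open import Data.List.Relation.Unary.Any using (Any)
open import Data.Maybe using (Maybe; just; nothing)
open import Data.Product using (Σ; ∃; _×_; _,_)
open import Data.Sum using (_⊎_)
open import Data.Empty using (⊥)
open import Relation.Nullary using (¬_)
open import Relation.Binary.PropositionalEquality using (_≡_; _≢_)
open import Function.Bundles using (_⇔_)

data Lit : Set where
  pos : ℕ → Lit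
  neg : ℕ → Lit

var : Lit → ℕ
var (pos v) = v
var (neg v) = v

compl : Lit → Lit
compl (pos v) = neg v
compl (neg v) = pos v

_==ℓ_ : Lit → Lit → Bool
pos a ==ℓ pos b = a ≡ᵇ b
neg a ==ℓ neg b = a ≡ᵇ b
_     ==ℓ _     = false

Clause : Set
Clause = List Lit

CNF : Set
CNF = List Clause

-- a cube (conjunction of literals); a DNF is a list of cubes (the empty list is ⊥)
Cube : Set
Cube = List Lit

DNF : Set
DNF = List Cube

Assignment : Set
Assignment = ℕ → Bool

evalLit : Assignment → Lit → Bool
evalLit α (pos v) = α v
evalLit α (neg v) = not (α v)

ClauseSat : Assignment → Clause → Set
ClauseSat α C = Any (λ l → evalLit α l ≡ true) C

CNFSat : Assignment → CNF → Set
CNFSat α P = All (ClauseSat α) P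

CubeSat : Assignment → Cube → Set
CubeSat α c = All (λ l → evalLit α l ≡ true) c

Entails : CNF → Clause → Set
Entails P D = ∀ α → CNFSat α P → ClauseSat α D

UnsatWith : CNF → Cube → Set
UnsatWith N c = ∀ α → CNFSat α N → CubeSat α c → ⊥

data Formula : Set where
  fvar : ℕ → Formula
  ftrue ffalse : Formula
  fnot : Formula → Formula
  fand for : Formula → Formula → Formula

evalF : Assignment → Formula → Bool
evalF α (fvar v) = α v
evalF α ftrue = true
evalF α ffalse = false
evalF α (fnot f) = not (evalF α f)
evalF α (fand f g) = evalF α f ∧ evalF α g
evalF α (for f g) = evalF α f ∨ evalF α g

varsF : Formula → List ℕ
varsF (fvar v) = v ∷ []
varsF ftrue = []
varsF ffalse = []
varsF (fnot f) = varsF f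
varsF (fand f g) = varsF f ++ varsF g
varsF (for f g) = varsF f ++ varsF g

varsCNF : CNF → List ℕ
varsCNF P = concatMap (map var) P

_⊆_ : List ℕ → List ℕ → Set
A ⊆ B = All (_∈ B) A

Disjoint : List ℕ → List ℕ → Set
Disjoint A B = ∀ {v} → v ∈ A → v ∈ B → ⊥

-- (∃ Z [P]) ≡ G : for every assignment α, G holds under α iff
-- some assignment β agreeing with α outside Z satisfies P.
ExistsEquiv : List ℕ → CNF → (Assignment → Set) → Set
ExistsEquiv Z P G =
  ∀ α → G α ⇔ (∃ λ β → (∀ v → v ∉ Z → β v ≡ α v) × CNFSat β P)

-- a trail entry: literal, reason (nothing = decision literal,
-- just C = propagated with reason C), decision level
record Entry : Set where
  constructor entry
  field
    lit    : Lit
    reason : Maybe Clause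
    level  : ℕ
open Entry public

Trail : Set
Trail = List Entry

isDecEntry : Entry → Bool
isDecEntry (entry _ nothing _) = true
isDecEntry (entry _ (just _) _) = false

memℕ : ℕ → List ℕ → Bool
memℕ v [] = false
memℕ v (w ∷ ws) = (v ≡ᵇ w) ∨ memℕ v ws

IsTrue : Trail → Lit → Set
IsTrue I l = l ∈ map lit I

IsFalse : Trail → Lit → Set
IsFalse I l = compl l ∈ map lit I

Assigned : Trail → ℕ → Set
Assigned I v = v ∈ map (λ e → var (lit e)) I

Unassigned : Trail → ℕ → Set
Unassigned I v = ¬ Assigned I v

isDecisionLit : Trail → Lit → Bool
isDecisionLit I l = any (λ e → isDecEntry e ∧ (lit e ==ℓ l)) I

-- δ(v): the level at which variable v is assigned (0 if unassigned)
levelOf : Trail → ℕ → ℕ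
levelOf [] v = 0
levelOf (e ∷ I) v = if var (lit e) ≡ᵇ v then level e else levelOf I v

δI : Trail → ℕ
δI I = foldr (λ e m → level e ⊔ m) 0 I

δC : Trail → Clause → ℕ
δC I C = foldr (λ l m → levelOf I (var l) ⊔ m) 0 C

removeLit : Lit → Clause → Clause
removeLit l C = filterᵇ (λ l' → not (l' ==ℓ l)) C

backjump : ℕ → Trail → Trail
backjump j I = filterᵇ (λ e → level e ≤ᵇ j) I

restrict : List ℕ → Trail → Cube
restrict Z I = filterᵇ (λ l → memℕ (var l) Z) (map lit I)

restrictCube : List ℕ → Cube → Cube
restrictCube Z c = filterᵇ (λ l → memℕ (var l) Z) c

Falsified : Trail → Clause → Set
Falsified I C = All (IsFalse I) C

Conflicting : Trail → CNF → Set
Conflicting I P = ∃ λ C → C ∈ P × Falsified I C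

IsUnit : Trail → Clause → Lit → Set
IsUnit I C l = l ∈ C × Unassigned I (var l) × All (λ l' → l' ≡ l ⊎ IsFalse I l') C

HasUnit : Trail → CNF → Set
HasUnit I P = ∃ λ C → ∃ λ l → C ∈ P × IsUnit I C l

tseitinAnd : ℕ → List Lit → CNF
tseitinAnd t ls = (pos t ∷ map compl ls) ∷ map (λ l → neg t ∷ l ∷ []) ls

record State : Set where
  constructor mkState
  field
    trail : Trail
    P     : CNF
    Nbase : CNF        -- Tseitin(t₀ ↔ ¬F) part of N (never modified)
    ts    : List ℕ
    defs  : CNF
    M     : DNF
    i     : ℕ
open State public

Ncnf : ℕ → State → CNF
Ncnf t0 s = (pos t0 ∷ map pos (ts s)) ∷ (Nbase s ++ defs s)

data Config : Set where
  running : State → Config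
  halted  : DNF → Config

initState : CNF → CNF → State
initState P₀ N₀ = mkState [] P₀ N₀ [] [] [] 0

module Procedure (X Y S T : List ℕ) (t0 : ℕ) where

  XYS : List ℕ
  XYS = X ++ Y ++ S

  Total : Trail → Set
  Total I = All (Assigned I) XYS

  data Step : Config → Config → Set where
    propagate : ∀ s C l →
      ¬ Conflicting (trail s) (P s) → C ∈ P s → IsUnit (trail s) C l →
      Step (running s)
           (running (record s { trail = trail s ∷ʳ entry l (just C) (δI (trail s)) }))
    conflict-stop : ∀ s C →
      C ∈ P s → Falsified (trail s) C → δC (trail s) C ≡ 0 →
      Step (running s) (halted (M s))
    conflict-learn : ∀ s C D l →
      C ∈ P s → Falsified (trail s) C → δC (trail s) C ≢ 0 →
      Entails (P s) D → Falsified (trail s) D →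
      l ∈ D → levelOf (trail s) (var l) ≡ δI (trail s) →
      All (λ l' → l' ≡ l ⊎ levelOf (trail s) (var l') ≢ δI (trail s)) D →
      let j = δC (trail s) (removeLit l D) in
      Step (running s)
           (running (record s { P = P s ++ (D ∷ [])
                              ; trail = backjump j (trail s) ∷ʳ entry l (just D) j }))
    model-stop : ∀ s →
      ¬ Conflicting (trail s) (P s) → Total (trail s) →
      All (λ e → isDecEntry e ≡ true → var (lit e) ∉ X) (trail s) →
      Step (running s) (halted (M s ++ (restrict X (trail s) ∷ [])))
    model-block : ∀ s (Istar : Cube) (t : ℕ) l →
      ¬ Conflicting (trail s) (P s) → Total (trail s) →
      Any (λ e → isDecEntry e ≡ true × var (lit e) ∈ X) (trail s) →
      All (_∈ restrict (X ++ Y) (trail s)) Istar →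
      UnsatWith (Ncnf t0 s) Istar →
      t ∉ XYS → t ∉ T → t ∉ varsCNF (Ncnf t0 s) →
      let I  = trail s
          m  = restrictCube X Istar
          dm = filterᵇ (isDecisionLit I) m
          B  = map compl dm in
      l ∈ B → All (λ l' → levelOf I (var l') ≤ levelOf I (var l)) B →
      let b = δC I (removeLit l B) in
      Step (running s)
           (running (record s { P = P s ++ (B ∷ [])
                              ; ts = ts s ∷ʳ t
                              ; defs = defs s ++ tseitinAnd t dm
                              ; M = M s ++ (m ∷ [])
                              ; i = suc (i s)
                              ; trail = backjump b I ∷ʳ entry l (just B) b }))
    decide : ∀ s v (b : Bool) →
      ¬ Conflicting (trail s) (P s) → ¬ HasUnit (trail s) (P s) →
      v ∈ XYS → Unassigned (trail s) v →
      (v ∈ X ⊎ All (Assigned (trail s)) X) →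
      Step (running s)
           (running (record s { trail = trail s ∷ʳ
                       entry (if b then pos v else neg v) nothing (suc (δI (trail s))) }))

-- Read the
-- decision flags of the trail as base-3 digits (decision 1, propagation 2), padded to
-- n digits where n is the number of variables of P. The trail never repeats a
-- variable, so it has at most n entries and the number stays below 3^n. Propagations
-- and decisions append a digit. Learning a clause and blocking a model both backjump
-- to a level below the level of the flipped literal: this cuts the trail just before
-- a decision and appends a propagated literal, i.e. turns a digit 1 into a 2 and
-- erases the digits after it. Every step thus increases the number.
{-# OPTIONS --safe #-}
module Submission where

open import Defs
open import Data.Bool using (Bool; true; false; not; T; T?; _∧_; if_then_else_)
open import Data.Bool.Properties using (T-≡; T-∧; T-not-≡)
open import Data.List using (List; []; _∷_; _++_; _∷ʳ_; map; filterᵇ; length)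
open import Data.List.Properties using (map-++; length-map; length-++; filter-accept; filter-reject; filter-none)
open import Data.List.Membership.Propositional using (_∈_; find)
open import Data.List.Membership.Propositional.Properties using (∈-map⁺; ∈-map⁻; ∈-filter⁺; ∈-filter⁻)
open import Data.List.Relation.Unary.All using (All; []; _∷_; lookup; tabulate)
import Data.List.Relation.Unary.All as All
import Data.List.Relation.Unary.All.Properties as Allₚ
open import Data.List.Relation.Unary.AllPairs using (AllPairs; []; _∷_)
import Data.List.Relation.Unary.AllPairs.Properties as AllPairs
open import Data.List.Relation.Unary.Any using (here; there)
open import Data.List.Relation.Unary.Any.Properties using (any⁻)
open import Data.List.Relation.Unary.Unique.Propositional using (Unique)
open import Data.Maybe using (just; nothing)
open import Data.Nat using (ℕ; zero; suc; _+_; _*_; _^_; _∸_; _≤_; _<_; _⊔_; _≤ᵇ_; _≡ᵇ_; _≤?_; z≤n; s≤s; NonZero)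
open import Data.Nat.Induction using (<-wellFounded)
open import Data.Nat.Properties
open import Data.Product using (∃; _×_; _,_; proj₁; proj₂; map₁)
open import Data.Sum using (inj₁; inj₂)
open import Function using (_∘_)
open import Function.Bundles using (Equivalence)
open import Induction.WellFounded using (Acc; acc)
open import Relation.Binary.PropositionalEquality
open import Relation.Nullary using (yes; no; contradiction)

open Equivalence using (to; from)

module _ {A : Set} where

  delete : (ys : List A) {x : A} → x ∈ ys → List A
  delete (y ∷ ys) (here _)  = ys
  delete (y ∷ ys) (there p) = y ∷ delete ys p

  length-delete : ∀ ys {x} (p : x ∈ ys) → length ys ≡ suc (length (delete ys p))
  length-delete (y ∷ ys) (here _)  = refl
  length-delete (y ∷ ys) (there p) = cong suc (length-delete ys p)

  ∈-delete⁺ : ∀ ys {x z} (p : x ∈ ys) → z ∈ ys → z ≢ x → z ∈ delete ys p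
  ∈-delete⁺ (y ∷ ys) (here refl) (here refl) z≢x = contradiction refl z≢x
  ∈-delete⁺ (y ∷ ys) (here refl) (there q)   _   = q
  ∈-delete⁺ (y ∷ ys) (there p)   (here refl) _   = here refl
  ∈-delete⁺ (y ∷ ys) (there p)   (there q)   z≢x = there (∈-delete⁺ ys p q z≢x)

  unique⇒length≤ : ∀ {xs ys : List A} → Unique xs → All (_∈ ys) xs → length xs ≤ length ys
  unique⇒length≤ {[]}              _               _          = z≤n
  unique⇒length≤ {x ∷ xs} {ys} (x≢xs ∷ uniq) (x∈ys ∷ xs⊆ys) =
    subst (suc (length xs) ≤_) (sym (length-delete ys x∈ys))
      (s≤s (unique⇒length≤ uniq
        (tabulate λ z∈xs → ∈-delete⁺ ys x∈ys (lookup xs⊆ys z∈xs) (≢-sym (lookup x≢xs z∈xs)))))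

  ≡-by-distinct-keys : ∀ {B : Set} (f : A → B) {xs x y} → AllPairs (λ u v → f u ≢ f v) xs →
    x ∈ xs → y ∈ xs → f x ≡ f y → x ≡ y
  ≡-by-distinct-keys f (_ ∷ _)  (here refl) (here refl) _ = refl
  ≡-by-distinct-keys f (p ∷ _)  (here refl) (there y∈) q = contradiction q (lookup p y∈)
  ≡-by-distinct-keys f (p ∷ _)  (there x∈) (here refl) q = contradiction (sym q) (lookup p x∈)
  ≡-by-distinct-keys f (_ ∷ ps) (there x∈) (there y∈) q = ≡-by-distinct-keys f ps x∈ y∈ q

digit : Bool → ℕ
digit true  = 1
digit false = 2

-- the word is read as the leading digits of an n-digit numeral
weight : ℕ → List Bool → ℕ
weight n       []      = 0
weight zero    (b ∷ w) = 0
weight (suc n) (b ∷ w) = digit b * 3 ^ n + weight n w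

weight<3^n : ∀ n w → length w ≤ n → weight n w < 3 ^ n
weight<3^n n       []      _        = m^n>0 3 n
weight<3^n (suc n) (b ∷ w) (s≤s w≤n) = begin-strict
  digit b * 3 ^ n + weight n w  <⟨ +-monoʳ-< (digit b * 3 ^ n) (weight<3^n n w w≤n) ⟩
  digit b * 3 ^ n + 3 ^ n       ≤⟨ +-monoˡ-≤ (3 ^ n) (*-monoˡ-≤ (3 ^ n) (digit≤2 b)) ⟩
  2 * 3 ^ n + 3 ^ n             ≡⟨ +-comm (2 * 3 ^ n) (3 ^ n) ⟩
  3 * 3 ^ n                     ∎
  where
  open ≤-Reasoning
  digit≤2 : ∀ b → digit b ≤ 2
  digit≤2 true  = s≤s z≤n
  digit≤2 false = ≤-refl

weight-∷ʳ : ∀ n w b → length w < n → weight n w < weight n (w ∷ʳ b)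
weight-∷ʳ (suc n) [] b _ = begin-strict
  0                       <⟨ m^n>0 3 n ⟩
  3 ^ n                   ≤⟨ m≤n*m (3 ^ n) (digit b) {{digit-nonZero b}} ⟩
  digit b * 3 ^ n         ≤⟨ m≤m+n (digit b * 3 ^ n) 0 ⟩
  digit b * 3 ^ n + 0     ∎
  where
  open ≤-Reasoning
  digit-nonZero : ∀ b → NonZero (digit b)
  digit-nonZero true  = _
  digit-nonZero false = _
weight-∷ʳ (suc n) (c ∷ w) b (s≤s w<n) = +-monoʳ-< (digit c * 3 ^ n) (weight-∷ʳ n w b w<n)

weight-flip : ∀ n u v → length (u ++ true ∷ v) ≤ n →
  weight n (u ++ true ∷ v) < weight n (u ∷ʳ false)
weight-flip (suc n) [] v (s≤s v≤n) = begin-strict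
  1 * 3 ^ n + weight n v  <⟨ +-monoʳ-< (1 * 3 ^ n) (weight<3^n n v v≤n) ⟩
  1 * 3 ^ n + 3 ^ n       ≡⟨ +-comm (1 * 3 ^ n) (3 ^ n) ⟩
  2 * 3 ^ n               ≡⟨ +-identityʳ (2 * 3 ^ n) ⟨
  2 * 3 ^ n + 0           ∎
  where open ≤-Reasoning
weight-flip (suc n) (c ∷ u) v (s≤s le) = +-monoʳ-< (digit c * 3 ^ n) (weight-flip n u v le)

==ℓ⇒≡ : ∀ a b → T (a ==ℓ b) → a ≡ b
==ℓ⇒≡ (pos a) (pos b) h = cong pos (≡ᵇ⇒≡ a b h)
==ℓ⇒≡ (neg a) (neg b) h = cong neg (≡ᵇ⇒≡ a b h)

==ℓ-refl : ∀ a → T (a ==ℓ a)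
==ℓ-refl (pos a) = ≡⇒≡ᵇ a a refl
==ℓ-refl (neg a) = ≡⇒≡ᵇ a a refl

var-compl : ∀ l → var (compl l) ≡ var l
var-compl (pos _) = refl
var-compl (neg _) = refl

compl-involutive : ∀ l → compl (compl l) ≡ l
compl-involutive (pos _) = refl
compl-involutive (neg _) = refl

compl-injective : ∀ {a b} → compl a ≡ compl b → a ≡ b
compl-injective {a} {b} eq = begin
  a                ≡⟨ compl-involutive a ⟨
  compl (compl a)  ≡⟨ cong compl eq ⟩
  compl (compl b)  ≡⟨ compl-involutive b ⟩
  b                ∎
  where open ≡-Reasoning

var-if : ∀ b v → var (if b then pos v else neg v) ≡ v
var-if true  _ = refl
var-if false _ = refl

∈-removeLit⁻ : ∀ l C {x} → x ∈ removeLit l C → x ∈ C × x ≢ l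
∈-removeLit⁻ l C x∈ with x∈C , keep ← ∈-filter⁻ (T? ∘ λ l′ → not (l′ ==ℓ l)) {xs = C} x∈ =
  x∈C , λ { refl → contradiction (==ℓ-refl l) (subst T (to T-not-≡ keep)) }

removeLit-⊆ : ∀ l C {x} → x ∈ removeLit l C → x ∈ C
removeLit-⊆ l C = proj₁ ∘ ∈-removeLit⁻ l C

vr : Entry → ℕ
vr e = var (lit e)

lit≡compl⇒vr≡ : ∀ e {l} → lit e ≡ compl l → vr e ≡ var l
lit≡compl⇒vr≡ _ {l} eq = trans (cong var eq) (var-compl l)

entry-assigned : ∀ {I e v} → e ∈ I → vr e ≡ v → Assigned I v
entry-assigned {I} e∈ refl = ∈-map⁺ vr e∈

δI-lub : ∀ I {k} → All (λ e → level e ≤ k) I → δI I ≤ k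
δI-lub []      []       = z≤n
δI-lub (e ∷ I) (p ∷ ps) = ⊔-lub p (δI-lub I ps)

δI-ub : ∀ I {e} → e ∈ I → level e ≤ δI I
δI-ub (x ∷ I) (here refl) = m≤m⊔n (level x) (δI I)
δI-ub (x ∷ I) (there e∈)  = ≤-trans (δI-ub I e∈) (m≤n⊔m (level x) (δI I))

levelOf-ub : ∀ I v → levelOf I v ≤ δI I
levelOf-ub []      v = z≤n
levelOf-ub (e ∷ I) v with vr e ≡ᵇ v
... | true  = m≤m⊔n (level e) (δI I)
... | false = ≤-trans (levelOf-ub I v) (m≤n⊔m (level e) (δI I))

levelOf-entry : ∀ I {v} → Assigned I v → ∃ λ e → e ∈ I × vr e ≡ v × levelOf I v ≡ level e
levelOf-entry (e ∷ I) {v} v∈ with vr e ≡ᵇ v in eq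
... | true = e , here refl , ≡ᵇ⇒≡ (vr e) v (from T-≡ eq) , refl
levelOf-entry (e ∷ I) {v} (here v≡e)  | false = contradiction (≡⇒≡ᵇ (vr e) v (sym v≡e)) (subst T eq)
levelOf-entry (e ∷ I) {v} (there v∈) | false with e′ , e′∈ , rest ← levelOf-entry I v∈ =
  e′ , there e′∈ , rest

δC-ub : ∀ I C {l} → l ∈ C → levelOf I (var l) ≤ δC I C
δC-ub I (x ∷ C) (here refl) = m≤m⊔n (levelOf I (var x)) (δC I C)
δC-ub I (x ∷ C) (there l∈)  = ≤-trans (δC-ub I C l∈) (m≤n⊔m (levelOf I (var x)) (δC I C))

δC-lub : ∀ I C {k} → All (λ l → levelOf I (var l) ≤ k) C → δC I C ≤ k
δC-lub I []      []       = z≤n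
δC-lub I (x ∷ C) (p ∷ ps) = ⊔-lub p (δC-lub I C ps)

δC-< : ∀ I C {k} → 0 < k → All (λ l → levelOf I (var l) < k) C → δC I C < k
δC-< I []      0<k []       = 0<k
δC-< I (x ∷ C) 0<k (p ∷ ps) = ⊔-pres-<m p (δC-< I C 0<k ps)

δC≤δI : ∀ I C → δC I C ≤ δI I
δC≤δI I C = δC-lub I C (tabulate λ {l} _ → levelOf-ub I (var l))

Follows : ℕ → Entry → Set
Follows a (entry _ nothing  k) = a < k
Follows a (entry _ (just _) k) = k ≡ a

data Leveled (a : ℕ) : Trail → Set where
  []  : Leveled a []
  _∷_ : ∀ {e I} → Follows a e → Leveled (level e) I → Leveled a (e ∷ I)

Follows⇒≤ : ∀ {a} e → Follows a e → a ≤ level e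
Follows⇒≤ (entry _ nothing  _) a<k  = <⇒≤ a<k
Follows⇒≤ (entry _ (just _) _) refl = ≤-refl

Follows-rising⇒decision : ∀ {a} e → Follows a e → a < level e → isDecEntry e ≡ true
Follows-rising⇒decision (entry _ nothing  _) _    _   = refl
Follows-rising⇒decision (entry _ (just _) _) refl a<a = contradiction a<a (n≮n _)

Leveled-∷ʳ : ∀ {a I e} → Leveled a I → Follows (a ⊔ δI I) e → Leveled a (I ∷ʳ e)
Leveled-∷ʳ {a} {e = e} [] f = subst (λ b → Follows b e) (⊔-identityʳ a) f ∷ []
Leveled-∷ʳ {a} {x ∷ I} {e} (fx ∷ lv) f = fx ∷ Leveled-∷ʳ lv (subst (λ b → Follows b e) a⊔δ≡δ f)
  where
  a⊔δ≡δ : a ⊔ (level x ⊔ δI I) ≡ level x ⊔ δI I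
  a⊔δ≡δ = m≤n⇒m⊔n≡n (≤-trans (Follows⇒≤ x fx) (m≤m⊔n (level x) (δI I)))

Leveled-++⁻ˡ : ∀ {a} u {w} → Leveled a (u ++ w) → Leveled a u
Leveled-++⁻ˡ []      _        = []
Leveled-++⁻ˡ (x ∷ u) (f ∷ lv) = f ∷ Leveled-++⁻ˡ u lv

Leveled-≤ : ∀ {a I e} → Leveled a I → e ∈ I → a ≤ level e
Leveled-≤ {I = x ∷ _} (f ∷ _)  (here refl) = Follows⇒≤ x f
Leveled-≤ {I = x ∷ _} (f ∷ lv) (there e∈)  = ≤-trans (Follows⇒≤ x f) (Leveled-≤ lv e∈)

Leveled-decision-< : ∀ {a I e} → Leveled a I → e ∈ I → isDecEntry e ≡ true → a < level e
Leveled-decision-< {I = entry _ nothing _ ∷ _}  (a<k ∷ _) (here refl) _  = a<k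
Leveled-decision-< {I = entry _ (just _) _ ∷ _} _         (here refl) ()
Leveled-decision-< {I = x ∷ _}                 (f ∷ lv)   (there e∈)  d =
  ≤-<-trans (Follows⇒≤ x f) (Leveled-decision-< lv e∈ d)

Leveled-decision-injective : ∀ {a I x y} → Leveled a I → x ∈ I → y ∈ I →
  isDecEntry x ≡ true → isDecEntry y ≡ true → level x ≡ level y → x ≡ y
Leveled-decision-injective _        (here refl) (here refl) _  _  _ = refl
Leveled-decision-injective (_ ∷ lv) (here refl) (there y∈)  _  dy q =
  contradiction q (<⇒≢ (Leveled-decision-< lv y∈ dy))
Leveled-decision-injective (_ ∷ lv) (there x∈)  (here refl) dx _  q =
  contradiction (sym q) (<⇒≢ (Leveled-decision-< lv x∈ dx))
Leveled-decision-injective (_ ∷ lv) (there x∈)  (there y∈)  dx dy q =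
  Leveled-decision-injective lv x∈ y∈ dx dy q

backjump-keep : ∀ {j e} I → level e ≤ j → backjump j (e ∷ I) ≡ e ∷ backjump j I
backjump-keep {j} {e} I e≤j = filter-accept (T? ∘ λ e → level e ≤ᵇ j) {e} {I} (≤⇒≤ᵇ e≤j)

backjump-drop : ∀ {j e} I → j < level e → backjump j (e ∷ I) ≡ backjump j I
backjump-drop {j} {e} I j<e =
  filter-reject (T? ∘ λ e → level e ≤ᵇ j) {e} {I} (<⇒≱ j<e ∘ ≤ᵇ⇒≤ (level e) j)

backjump-below-base : ∀ {a I j} → Leveled a I → j < a → backjump j I ≡ []
backjump-below-base {j = j} lv j<a = filter-none (T? ∘ λ e → level e ≤ᵇ j)
  (tabulate λ {e} e∈ → <⇒≱ (<-≤-trans j<a (Leveled-≤ lv e∈)) ∘ ≤ᵇ⇒≤ (level e) j)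

backjump-≤ : ∀ j I → All (λ e → level e ≤ j) (backjump j I)
backjump-≤ j I = tabulate λ {e} e∈ →
  ≤ᵇ⇒≤ (level e) j (proj₂ (∈-filter⁻ (T? ∘ λ e → level e ≤ᵇ j) {xs = I} e∈))

backjump-⊆ : ∀ j I {e} → e ∈ backjump j I → e ∈ I
backjump-⊆ j I e∈ = proj₁ (∈-filter⁻ (T? ∘ λ e → level e ≤ᵇ j) {xs = I} e∈)

∈-backjump⁺ : ∀ j I {e} → e ∈ I → level e ≤ j → e ∈ backjump j I
∈-backjump⁺ j I e∈ e≤j = ∈-filter⁺ (T? ∘ λ e → level e ≤ᵇ j) e∈ (≤⇒≤ᵇ e≤j)

-- δC I R is 0 or the level of an entry of I, and that entry survives the backjump
δC≤δI-backjump : ∀ I R → All (λ l → Assigned I (var l)) R → δC I R ≤ δI (backjump (δC I R) I)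
δC≤δI-backjump I R assigned = δC-lub I R (tabulate bound)
  where
  bound : ∀ {l} → l ∈ R → levelOf I (var l) ≤ δI (backjump (δC I R) I)
  bound {l} l∈ with e , e∈ , _ , lvl ← levelOf-entry I (lookup assigned l∈) =
    subst (_≤ δI (backjump (δC I R) I)) (sym lvl)
      (δI-ub _ (∈-backjump⁺ (δC I R) I e∈ (subst (_≤ δC I R) lvl (δC-ub I R l∈))))

data CutAtDecision (j : ℕ) (I : Trail) : Set where
  cut : ∀ u d v → I ≡ u ++ d ∷ v → backjump j I ≡ u → isDecEntry d ≡ true → CutAtDecision j I

-- levels never decrease along the trail and only rise at decisions
backjump-cuts-at-decision : ∀ {a I e j} → Leveled a I → a ≤ j → e ∈ I → j < level e →
  CutAtDecision j I
backjump-cuts-at-decision {I = x ∷ I} {j = j} (f ∷ lv) a≤j e∈ j<e with level x ≤? j | e∈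
... | yes x≤j | here refl = contradiction x≤j (<⇒≱ j<e)
... | yes x≤j | there e∈I with cut u d v I≡ bj≡ dec ← backjump-cuts-at-decision lv x≤j e∈I j<e =
  cut (x ∷ u) d v (cong (x ∷_) I≡) (trans (backjump-keep I x≤j) (cong (x ∷_) bj≡)) dec
... | no  x≰j | _ = cut [] x I refl
  (trans (backjump-drop I (≰⇒> x≰j)) (backjump-below-base lv (≰⇒> x≰j)))
  (Follows-rising⇒decision x f (≤-<-trans a≤j (≰⇒> x≰j)))

module Termination (X Y S T : List ℕ) (t0 : ℕ) where
  open Procedure X Y S T t0

  n : ℕ
  n = length XYS

  record WellFormed (I : Trail) : Set where
    field
      distinct : AllPairs (λ e e′ → vr e ≢ vr e′) I
      in-scope : All (λ e → vr e ∈ XYS) I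
      leveled  : Leveled 0 I
  open WellFormed

  Invariant : State → Set
  Invariant s = WellFormed (trail s) × All (All (λ l → var l ∈ XYS)) (P s)

  rank : Trail → ℕ
  rank I = weight n (map isDecEntry I)

  length≤n : ∀ {I} → WellFormed I → length I ≤ n
  length≤n {I} wf = subst (_≤ n) (length-map vr I)
    (unique⇒length≤ (AllPairs.map⁺ (distinct wf)) (Allₚ.map⁺ (in-scope wf)))

  rank<3^n : ∀ {I} → WellFormed I → rank I < 3 ^ n
  rank<3^n {I} wf =
    weight<3^n n (map isDecEntry I) (subst (_≤ n) (sym (length-map isDecEntry I)) (length≤n wf))

  levelOf-∈ : ∀ {I e} → WellFormed I → e ∈ I → levelOf I (vr e) ≡ level e
  levelOf-∈ {I} wf e∈ with e′ , e′∈ , same , lvl ← levelOf-entry I (∈-map⁺ vr e∈) =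
    trans lvl (cong level (≡-by-distinct-keys vr (distinct wf) e′∈ e∈ same))

  levelOf-compl : ∀ {I e l} → WellFormed I → e ∈ I → lit e ≡ compl l → levelOf I (var l) ≡ level e
  levelOf-compl {I} {e} wf e∈ e-lit =
    trans (cong (levelOf I) (sym (lit≡compl⇒vr≡ e e-lit))) (levelOf-∈ wf e∈)

  falsified-entry : ∀ {I l} → IsFalse I l → ∃ λ e → e ∈ I × vr e ≡ var l
  falsified-entry f with e , e∈ , eq ← ∈-map⁻ lit f = e , e∈ , lit≡compl⇒vr≡ e (sym eq)

  falsified-assigned : ∀ {I l} → IsFalse I l → Assigned I (var l)
  falsified-assigned f with e , e∈ , same ← falsified-entry f = entry-assigned e∈ same

  assigned-in-scope : ∀ {I v} → WellFormed I → Assigned I v → v ∈ XYS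
  assigned-in-scope {I} wf v∈ with e , e∈ , refl ← ∈-map⁻ vr v∈ = lookup (in-scope wf) e∈

  extend : ∀ {I e} → WellFormed I → Unassigned I (vr e) → vr e ∈ XYS → Follows (δI I) e →
    WellFormed (I ∷ʳ e) × rank I < rank (I ∷ʳ e)
  extend {I} {e} wf unassigned e∈XYS f = wf′ , rank-grows
    where
    wf′ : WellFormed (I ∷ʳ e)
    wf′ = record
      { distinct = AllPairs.++⁺ (distinct wf) ([] ∷ [])
                     (tabulate λ x∈ → (unassigned ∘ entry-assigned x∈) ∷ [])
      ; in-scope = Allₚ.∷ʳ⁺ (in-scope wf) e∈XYS
      ; leveled  = Leveled-∷ʳ (leveled wf) f
      }
    length<n : length (map isDecEntry I) < n
    length<n = begin-strict
      length (map isDecEntry I)  ≡⟨ length-map isDecEntry I ⟩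
      length I                   <⟨ n<1+n (length I) ⟩
      suc (length I)             ≡⟨ +-comm 1 (length I) ⟩
      length I + 1               ≡⟨ length-++ I ⟨
      length (I ∷ʳ e)            ≤⟨ length≤n wf′ ⟩
      n                          ∎
      where open ≤-Reasoning
    rank-grows : rank I < rank (I ∷ʳ e)
    rank-grows = subst (weight n (map isDecEntry I) <_) (cong (weight n) (sym (map-++ isDecEntry I (e ∷ []))))
      (weight-∷ʳ n (map isDecEntry I) (isDecEntry e) length<n)

  rank-flip : ∀ {I u d v r j l} → WellFormed I → I ≡ u ++ d ∷ v → isDecEntry d ≡ true →
    rank I < rank (u ∷ʳ entry l (just r) j)
  rank-flip {I} {u} {d} {v} {r} {j} {l} wf I≡ dec = subst₂ (λ w w′ → weight n w < weight n w′)
    (sym word-before) (sym word-after)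
    (weight-flip n (map isDecEntry u) (map isDecEntry v)
      (subst (_≤ n) (trans (sym (length-map isDecEntry I)) (cong length word-before)) (length≤n wf)))
    where
    open ≡-Reasoning
    word-before : map isDecEntry I ≡ map isDecEntry u ++ true ∷ map isDecEntry v
    word-before = begin
      map isDecEntry I             ≡⟨ cong (map isDecEntry) I≡ ⟩
      map isDecEntry (u ++ d ∷ v)  ≡⟨ map-++ isDecEntry u (d ∷ v) ⟩
      map isDecEntry u ++ isDecEntry d ∷ map isDecEntry v
        ≡⟨ cong (λ b → map isDecEntry u ++ b ∷ map isDecEntry v) dec ⟩
      map isDecEntry u ++ true ∷ map isDecEntry v ∎
    word-after : map isDecEntry (u ∷ʳ entry l (just r) j) ≡ map isDecEntry u ∷ʳ false
    word-after = map-++ isDecEntry u (entry l (just r) j ∷ [])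

  backjump-then-propagate : ∀ {I l r j} → WellFormed I → Assigned I (var l) →
    j < levelOf I (var l) → j ≤ δI (backjump j I) →
    let I′ = backjump j I ∷ʳ entry l (just r) j in WellFormed I′ × rank I < rank I′
  backjump-then-propagate {I} {l} {r} {j} wf assigned j<l j≤δ
    with e , e∈ , same , lvl ← levelOf-entry I assigned
    with cut u d v I≡ bj≡ dec ← backjump-cuts-at-decision (leveled wf) z≤n e∈ (subst (j <_) lvl j<l) =
    wf′ , rank-grows
    where
    j<e : j < level e
    j<e = subst (j <_) lvl j<l
    new : Entry
    new = entry l (just r) j
    fresh : All (λ x → vr x ≢ var l) (backjump j I)
    fresh = tabulate λ {x} x∈ same′ → <⇒≱ j<e
      (subst (_≤ j)
        (cong level (≡-by-distinct-keys vr (distinct wf) (backjump-⊆ j I x∈) e∈ (trans same′ (sym same))))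
        (lookup (backjump-≤ j I) x∈))
    leveled-prefix : Leveled 0 (backjump j I)
    leveled-prefix = subst (Leveled 0) (sym bj≡) (Leveled-++⁻ˡ u (subst (Leveled 0) I≡ (leveled wf)))
    wf′ : WellFormed (backjump j I ∷ʳ new)
    wf′ = record
      { distinct = AllPairs.++⁺ (AllPairs.filter⁺ (T? ∘ λ e → level e ≤ᵇ j) (distinct wf)) ([] ∷ [])
                     (All.map (_∷ []) fresh)
      ; in-scope = Allₚ.∷ʳ⁺ (tabulate λ x∈ → lookup (in-scope wf) (backjump-⊆ j I x∈))
                     (subst (_∈ XYS) same (lookup (in-scope wf) e∈))
      ; leveled  = Leveled-∷ʳ leveled-prefix (≤-antisym j≤δ (δI-lub (backjump j I) (backjump-≤ j I)))
      }
    rank-grows : rank I < rank (backjump j I ∷ʳ new)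
    rank-grows = subst (λ w → rank I < rank (w ∷ʳ new)) (sym bj≡) (rank-flip wf I≡ dec)

  NegatedDecisions : Trail → Clause → Set
  NegatedDecisions I B = All (λ l → ∃ λ e → e ∈ I × isDecEntry e ≡ true × lit e ≡ compl l) B

  negatedDecisions : ∀ I c → NegatedDecisions I (map compl (filterᵇ (isDecisionLit I) c))
  negatedDecisions I c = Allₚ.map⁺ (tabulate decision)
    where
    decision : ∀ {x} → x ∈ filterᵇ (isDecisionLit I) c →
      ∃ λ e → e ∈ I × isDecEntry e ≡ true × lit e ≡ compl (compl x)
    decision {x} x∈
      with _ , isDec ← ∈-filter⁻ (T? ∘ isDecisionLit I) {xs = c} x∈
      with e , e∈ , both ← find (any⁻ (λ e → isDecEntry e ∧ (lit e ==ℓ x)) I isDec)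
      with dec , same ← to T-∧ both
      = e , e∈ , to T-≡ dec , trans (==ℓ⇒≡ (lit e) x same) (sym (compl-involutive x))

  -- the flipped literal l is the complement of a decision, so its level is one that
  -- no other literal of B can share
  δC-removeLit-<-negatedDecisions : ∀ {I B l} → WellFormed I → NegatedDecisions I B → l ∈ B →
    All (λ l′ → levelOf I (var l′) ≤ levelOf I (var l)) B → δC I (removeLit l B) < levelOf I (var l)
  δC-removeLit-<-negatedDecisions {I} {B} {l} wf negated l∈B highest
    with e , e∈ , e-dec , e-lit ← lookup negated l∈B =
    subst (δC I (removeLit l B) <_) (sym (levelOf-compl wf e∈ e-lit))
      (δC-< I (removeLit l B) (Leveled-decision-< (leveled wf) e∈ e-dec) (tabulate below))
    where
    below : ∀ {l′} → l′ ∈ removeLit l B → levelOf I (var l′) < level e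
    below {l′} l′∈ with l′∈B , l′≢l ← ∈-removeLit⁻ l B l′∈
      with e′ , e′∈ , e′-dec , e′-lit ← lookup negated l′∈B =
      subst (_< level e) (sym (levelOf-compl wf e′∈ e′-lit)) (≤∧≢⇒< e′≤e e′≢e)
      where
      e′≤e : level e′ ≤ level e
      e′≤e = subst₂ _≤_ (levelOf-compl wf e′∈ e′-lit) (levelOf-compl wf e∈ e-lit) (lookup highest l′∈B)
      e′≢e : level e′ ≢ level e
      e′≢e same-level = l′≢l (compl-injective (begin
        compl l′  ≡⟨ e′-lit ⟨
        lit e′    ≡⟨ cong lit (Leveled-decision-injective (leveled wf) e′∈ e∈ e′-dec e-dec same-level) ⟩
        lit e     ≡⟨ e-lit ⟩
        compl l   ∎))
        where open ≡-Reasoning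

  step-preserves : ∀ {s s′} → Invariant s → Step (running s) (running s′) →
    Invariant s′ × rank (trail s) < rank (trail s′)
  step-preserves (wf , scoped) (propagate s C l _ C∈ (l∈C , unassigned , _)) =
    map₁ (_, scoped) (extend wf unassigned (lookup (lookup scoped C∈) l∈C) refl)
  step-preserves (wf , scoped) (decide s v b _ _ v∈XYS unassigned _) =
    map₁ (_, scoped) (extend {e = entry (if b then pos v else neg v) nothing (suc (δI (trail s)))} wf
      (subst (Unassigned (trail s)) (sym (var-if b v)) unassigned)
      (subst (_∈ XYS) (sym (var-if b v)) v∈XYS) (n<1+n (δI (trail s))))
  step-preserves (wf , scoped) (conflict-learn s C D l C∈ C-false δC≢0 _ D-false l∈D l-top others) =
    map₁ (_, Allₚ.∷ʳ⁺ scoped (All.map (assigned-in-scope wf) D-assigned))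
      (backjump-then-propagate wf (lookup D-assigned l∈D)
        (subst (δC I (removeLit l D) <_) (sym l-top) (δC-< I (removeLit l D) 0<δI (tabulate below-top)))
        (δC≤δI-backjump I (removeLit l D) (Allₚ.anti-mono (removeLit-⊆ l D) D-assigned)))
    where
    I : Trail
    I = trail s
    D-assigned : All (λ l′ → Assigned I (var l′)) D
    D-assigned = All.map falsified-assigned D-false
    0<δI : 0 < δI I
    0<δI = n≢0⇒n>0 λ δI≡0 → δC≢0 (n≤0⇒n≡0 (subst (δC I C ≤_) δI≡0 (δC≤δI I C)))
    below-top : ∀ {l′} → l′ ∈ removeLit l D → levelOf I (var l′) < δI I
    below-top {l′} l′∈ with l′∈D , l′≢l ← ∈-removeLit⁻ l D l′∈ | lookup others l′∈D
    ... | inj₁ l′≡l   = contradiction l′≡l l′≢l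
    ... | inj₂ not-top = ≤∧≢⇒< (levelOf-ub I (var l′)) not-top
  step-preserves (wf , scoped) (model-block s Istar _ l _ _ _ _ _ _ _ _ l∈B highest) =
    map₁ (_, Allₚ.∷ʳ⁺ scoped (All.map (assigned-in-scope wf) B-assigned))
      (backjump-then-propagate wf (lookup B-assigned l∈B)
        (δC-removeLit-<-negatedDecisions wf negated l∈B highest)
        (δC≤δI-backjump I (removeLit l B) (Allₚ.anti-mono (removeLit-⊆ l B) B-assigned)))
    where
    I : Trail
    I = trail s
    B : Clause
    B = map compl (filterᵇ (isDecisionLit I) (restrictCube X Istar))
    negated : NegatedDecisions I B
    negated = negatedDecisions I (restrictCube X Istar)
    B-assigned : All (λ l′ → Assigned I (var l′)) B
    B-assigned = All.map (λ (e , e∈ , _ , e-lit) → entry-assigned e∈ (lit≡compl⇒vr≡ e e-lit)) negated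

  terminates : ∀ s → Invariant s → Acc _<_ (3 ^ n ∸ rank (trail s)) →
    Acc (λ c′ c → Step c c′) (running s)
  terminates s inv (acc smaller) = acc next
    where
    next : ∀ {c′} → Step (running s) c′ → Acc (λ c′ c → Step c c′) c′
    next {halted _}  _ = acc λ ()
    next {running s′} step with inv′ , grows ← step-preserves inv step =
      terminates s′ inv′ (smaller (∸-monoʳ-< grows (<⇒≤ (rank<3^n (proj₁ inv′)))))

  clauses-in-scope : ∀ P₀ → varsCNF P₀ ⊆ XYS → All (All (λ l → var l ∈ XYS)) P₀
  clauses-in-scope []       _        = []
  clauses-in-scope (C ∷ P₀) P₀⊆XYS with C⊆XYS , rest ← Allₚ.++⁻ (map var C) P₀⊆XYS =
    Allₚ.map⁻ C⊆XYS ∷ clauses-in-scope P₀ rest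

proposition4 : (X Y S T : List ℕ) (F : Formula) (P₀ : CNF) (t0 : ℕ) (N₀ : CNF) →
    Disjoint X Y → Disjoint X S → Disjoint Y S →
    Disjoint X T → Disjoint Y T → Disjoint S T →
    varsF F ⊆ (X ++ Y) →
    varsCNF P₀ ⊆ (X ++ Y ++ S) →
    ExistsEquiv S P₀ (λ α → evalF α F ≡ true) →
    t0 ∈ T →
    varsCNF ((pos t0 ∷ []) ∷ N₀) ⊆ (X ++ Y ++ T) →
    ExistsEquiv T ((pos t0 ∷ []) ∷ N₀) (λ α → evalF α F ≡ false) →
    Acc (λ c′ c → Procedure.Step X Y S T t0 c c′) (running (initState P₀ N₀))
proposition4 X Y S T F P₀ t0 N₀ _ _ _ _ _ _ _ P₀⊆XYS _ _ _ _ =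
  terminates (initState P₀ N₀) (empty-wellFormed , clauses-in-scope P₀ P₀⊆XYS) (<-wellFounded _)
  where
  open Termination X Y S T t0
  empty-wellFormed : WellFormed []
  empty-wellFormed = record { distinct = [] ; in-scope = [] ; leveled = [] }
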